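{- Let $n>3$, $n_1=n(n+1)/2$, and let $[G]$ and $[H]$ be binding graphs of order $n_1$ with basic graphs $G$ and $H$, such that $\mathrm{Var}([G])=\mathrm{Var}([H])$. Then: (1) no basic vertex lies in the same orbit of $\mathrm{Aut}([G])$ as a binding vertex; (2) $G\cong H$ if and only if $[G]\cong[H]$; (3) $\mathrm{Aut}([G])\cong\mathrm{Aut}(G)$ as groups.
   Context: Labeled graphs: $\mathrm{Var}$ is an infinite set of independent variables and $x_0\notin\mathrm{Var}$ a reserved symbol. A labeled graph of order $N$ is an $N\times N$ matrix $(g_{ij})$ with entries in $\{x_0\}\cup\mathrm{Var}$; vertex set $[N]$; for $i\neq j$, $(i,j)$ is an edge iff $g_{ij}\ne x_0$. $\mathrm{Var}(G)$ is the set of symbols occurring in $G$. A simple graph has $G^\top=G$, $|\mathrm{Var}(G)|\le2$, $g_{ii}=x_0$. $G\cong H$ means there is a permutation $\sigma$ of $[N]$ with $g_{ij}=h_{i^\sigma j^\sigma}$ for all $i,j$; $\mathrm{Aut}(G)$ is the group of such $\sigma$ with $H=G$. Binding graphs: a binding graph of order $n_1=n(n+1)/2$ ($n\ge2$) is a simple graph such that for every pair of distinct $u,v\in[n]$ there is a unique vertex $u\wedge v\in[n+1,n_1]$ whose neighbours are exactly $u$ and $v$, distinct pairs giving distinct vertices. The subgraph induced on $[n]$ is the basic graph $G$ and the binding graph is denoted $[G]$; vertices in $[n]$ are basic, vertices in $[n+1,n_1]$ are binding. -}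

module Defs where

open import Level using (0ℓ)
open import Data.Nat using (ℕ; zero; suc; _*_; _≤_; _<_; z≤n; s≤s; NonZero)
open import Data.Nat.Properties using (≤-refl; *-monoʳ-≤; *-comm)
open import Data.Nat.DivMod using (_/_; m*n/n≡m; /-monoˡ-≤)
open import Data.Fin using (Fin; toℕ; inject≤)
open import Data.Fin.Permutation using (Permutation; _⟨$⟩ʳ_; _⟨$⟩ˡ_; _∘ₚ_; flip; id; inverseʳ)
open import Data.Product using (Σ; ∃; ∃₂; ∃!; _×_; _,_)
open import Data.Sum using (_⊎_)
open import Function.Bundles using (_⇔_)
open import Relation.Binary.PropositionalEquality using (_≡_; _≢_; refl; sym; trans; cong₂; subst)
open import Algebra.Bundles.Raw using (RawGroup)
open import Algebra.Morphism.Structures using (module GroupMorphisms)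

data Sym : Set where
  x₀  : Sym
  var : ℕ → Sym

LGraph : ℕ → Set
LGraph N = Fin N → Fin N → Sym

Occurs : ∀ {N} → LGraph N → Sym → Set
Occurs G s = ∃₂ λ i j → G i j ≡ s

SameVars : ∀ {N} → LGraph N → LGraph N → Set
SameVars G H = ∀ s → Occurs G s ⇔ Occurs H s

AtMostTwoVars : ∀ {N} → LGraph N → Set
AtMostTwoVars G = ∀ s t r → Occurs G s → Occurs G t → Occurs G r →
                  s ≡ t ⊎ s ≡ r ⊎ t ≡ r

record IsSimple {N} (G : LGraph N) : Set where
  field
    symmetric : ∀ i j → G i j ≡ G j i
    twoVars   : AtMostTwoVars G
    diag      : ∀ i → G i i ≡ x₀

Adj : ∀ {N} → LGraph N → Fin N → Fin N → Set
Adj G i j = i ≢ j × G i j ≢ x₀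

NeighboursExactly : ∀ {N} → LGraph N → Fin N → Fin N → Fin N → Set
NeighboursExactly G w u v = ∀ x → Adj G w x ⇔ (x ≡ u ⊎ x ≡ v)

n₁ : ℕ → ℕ
n₁ n = n * suc n / 2

n≤n₁ : ∀ n → n ≤ n₁ n
n≤n₁ zero = z≤n
n≤n₁ (suc k) = subst (_≤ n₁ (suc k)) (m*n/n≡m (suc k) 2)
  (/-monoˡ-≤ 2 (*-monoʳ-≤ (suc k) {2} {suc (suc k)} (s≤s (s≤s z≤n))))

basicV : ∀ n → Fin n → Fin (n₁ n)
basicV n i = inject≤ i (n≤n₁ n)

IsBasicVertex : ∀ n → Fin (n₁ n) → Set
IsBasicVertex n i = toℕ i < n

IsBindingVertex : ∀ n → Fin (n₁ n) → Set
IsBindingVertex n i = n ≤ toℕ i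

record IsBindingGraph (n : ℕ) (B : LGraph (n₁ n)) : Set where
  field
    n≥2     : 2 ≤ n
    simple  : IsSimple B
    binding : ∀ (u v : Fin n) → u ≢ v →
              ∃! _≡_ λ w → IsBindingVertex n w ×
                           NeighboursExactly B w (basicV n u) (basicV n v)
    distinct : ∀ (u v u′ v′ : Fin n) (w w′ : Fin (n₁ n)) →
               NeighboursExactly B w (basicV n u) (basicV n v) →
               NeighboursExactly B w′ (basicV n u′) (basicV n v′) →
               w ≡ w′ → (u ≡ u′ × v ≡ v′) ⊎ (u ≡ v′ × v ≡ u′)

basicGraph : ∀ n → LGraph (n₁ n) → LGraph n
basicGraph n B i j = B (basicV n i) (basicV n j)

Maps : ∀ {N} → LGraph N → LGraph N → Permutation N N → Set
Maps G H σ = ∀ i j → G i j ≡ H (σ ⟨$⟩ʳ i) (σ ⟨$⟩ʳ j)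

_≅_ : ∀ {N} → LGraph N → LGraph N → Set
G ≅ H = ∃ λ σ → Maps G H σ

IsAut : ∀ {N} → LGraph N → Permutation N N → Set
IsAut G σ = Maps G G σ

Aut : ∀ {N} → LGraph N → Set
Aut {N} G = Σ (Permutation N N) (IsAut G)

SameOrbit : ∀ {N} → LGraph N → Fin N → Fin N → Set
SameOrbit G u w = ∃ λ (σ : Aut G) → Data.Product.proj₁ σ ⟨$⟩ʳ u ≡ w
  where import Data.Product

-- group structure on Aut(G): composition (first σ then τ), identity, inverse
private
  module _ {N} (G : LGraph N) where
    ∘-aut : Aut G → Aut G → Aut G
    ∘-aut (σ , p) (τ , q) = σ ∘ₚ τ , λ i j →
      trans (p i j) (q (σ ⟨$⟩ʳ i) (σ ⟨$⟩ʳ j))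

    id-aut : Aut G
    id-aut = id , λ i j → refl

    inv-aut : Aut G → Aut G
    inv-aut (σ , p) = flip σ , λ i j →
      sym (trans (p (σ ⟨$⟩ˡ i) (σ ⟨$⟩ˡ j))
                 (cong₂ G (inverseʳ σ) (inverseʳ σ)))

AutRawGroup : ∀ {N} → LGraph N → RawGroup 0ℓ 0ℓ
AutRawGroup {N} G = record
  { Carrier = Aut G
  ; _≈_     = λ σ τ → ∀ i → Data.Product.proj₁ σ ⟨$⟩ʳ i ≡ Data.Product.proj₁ τ ⟨$⟩ʳ i
  ; _∙_     = ∘-aut G
  ; ε       = id-aut G
  ; _⁻¹     = inv-aut G
  }
  where import Data.Product

AutIsomorphic : ∀ {N M} → LGraph N → LGraph M → Set
AutIsomorphic G H =
  ∃ λ (φ : Aut G → Aut H) →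
    GroupMorphisms.IsGroupIsomorphism (AutRawGroup G) (AutRawGroup H) φ

{-# OPTIONS --safe #-}
module Submission where

open import Defs
open import Data.Nat using (ℕ; _<_)
open import Data.Product using (_×_)
open import Function.Bundles using (_⇔_)
open import Relation.Nullary using (¬_)

open import Data.Nat using (zero; suc; _+_; _*_; _≤_; z≤n; s≤s)
import Data.Nat.Properties as ℕP
open import Data.Nat.DivMod using (_/_; m*n/n≡m; +-distrib-/-∣ʳ)
open import Data.Nat.Divisibility using (divides)
open import Data.Nat.Tactic.RingSolver using (solve-∀)
open import Data.Fin as F using (Fin; toℕ; inject₁; fromℕ; splitAt; cast; punchOut)
import Data.Fin.Properties as FP
open import Data.Fin.Permutation using (Permutation; permutation; _⟨$⟩ʳ_; _⟨$⟩ˡ_; flip; inverseʳ; inverseˡ)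
open import Data.Product using (Σ; ∃; _,_; proj₁; proj₂)
import Data.Product as Prod
open import Data.Product.Properties using (,-injective; ,-injectiveˡ; ,-injectiveʳ)
open import Data.Sum using (_⊎_; inj₁; inj₂)
import Data.Sum as Sum
open import Data.Sum.Function.Propositional using (_⊎-⇔_)
open import Data.Empty using (⊥-elim)
open import Relation.Nullary using (yes; no)
open import Relation.Binary.PropositionalEquality
open import Function using (_∘_; id)
open import Function.Definitions using (Injective)
open import Function.Bundles using (mk⇔; Equivalence; Inverse; Injection)
open Equivalence using (to; from)
import Function.Properties.Equivalence as ⇔
open import Function.Properties.Inverse using (↔⇒↣)
open import Algebra.Bundles.Raw using (RawGroup)
open import Algebra.Morphism.Structures using (module GroupMorphisms)

-- Counting shows that every vertex of a binding graph is either a basic vertex u or the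
-- binding vertex u ∧ v of a pair u ≢ v: the pairs (i , j) with j ≤ i are exactly n₁ many and
-- go injectively to vertices (i ↦ i, (i , j) ↦ i ∧ j).  All edges carry a single label, so
-- an entry is determined by adjacency.  For n > 3 a basic vertex u has the three distinct
-- neighbours u ∧ k, whereas u ∧ v has only two; hence every isomorphism τ of binding graphs
-- maps basic vertices to basic vertices and then u ∧ v to τ u ∧ τ v, i.e. τ is determined by
-- its restriction to the basic graph.  Conversely an isomorphism σ of basic graphs extends by
-- u ∧ v ↦ σ u ∧ σ v, using that Var([G]) = Var([H]) forces the two labels to agree.

n₁-suc : ∀ n → n₁ (suc n) ≡ n₁ n + suc n
n₁-suc n = begin
  suc n * suc (suc n) / 2      ≡⟨ cong (_/ 2) (expand n) ⟩
  (n * suc n + suc n * 2) / 2  ≡⟨ +-distrib-/-∣ʳ (n * suc n) (divides (suc n) refl) ⟩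
  n₁ n + suc n * 2 / 2         ≡⟨ cong (n₁ n +_) (m*n/n≡m (suc n) 2) ⟩
  n₁ n + suc n                 ∎
  where
  open ≡-Reasoning
  expand : ∀ n → suc n * suc (suc n) ≡ n * suc n + suc n * 2
  expand = solve-∀

cast-injective : ∀ {m n} .(eq : m ≡ n) → Injective _≡_ _≡_ (cast eq)
cast-injective eq {x} {y} h =
  trans (sym (FP.cast-involutive _ eq x)) (trans (cong (cast (sym eq)) h) (FP.cast-involutive _ eq y))

splitAt-injective : ∀ m {n} → Injective _≡_ _≡_ (splitAt m {n})
splitAt-injective m {n} {x} {y} h =
  trans (sym (FP.join-splitAt m n x)) (trans (cong (F.join m n) h) (FP.join-splitAt m n y))

LowerPair : ∀ {n} → Fin n × Fin n → Set
LowerPair (i , j) = j F.≤ i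

lowerPair : ∀ n → Fin (n₁ n) → Fin n × Fin n
lowerPairStep : ∀ n → Fin (n₁ n) ⊎ Fin (suc n) → Fin (suc n) × Fin (suc n)

lowerPair zero    ()
lowerPair (suc n) = lowerPairStep n ∘ splitAt (n₁ n) ∘ cast (n₁-suc n)

lowerPairStep n (inj₁ k) = Prod.map inject₁ inject₁ (lowerPair n k)
lowerPairStep n (inj₂ j) = fromℕ n , j

lowerPair-lower : ∀ n k → LowerPair (lowerPair n k)
lowerPairStep-lower : ∀ n s → LowerPair (lowerPairStep n s)

lowerPair-lower zero    ()
lowerPair-lower (suc n) = lowerPairStep-lower n ∘ splitAt (n₁ n) ∘ cast (n₁-suc n)

lowerPairStep-lower n (inj₁ k) =
  subst₂ _≤_ (sym (FP.toℕ-inject₁ _)) (sym (FP.toℕ-inject₁ _)) (lowerPair-lower n k)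
lowerPairStep-lower n (inj₂ j) = FP.≤fromℕ j

lowerPair-injective : ∀ n → Injective _≡_ _≡_ (lowerPair n)
lowerPairStep-injective : ∀ n → Injective _≡_ _≡_ (lowerPairStep n)

lowerPair-injective zero {()}
lowerPair-injective (suc n) =
  cast-injective (n₁-suc n) ∘ splitAt-injective (n₁ n) ∘ lowerPairStep-injective n

lowerPairStep-injective n {inj₁ k} {inj₁ k′} eq with ,-injective eq
... | i≡i′ , j≡j′ = cong inj₁ (lowerPair-injective n
  (cong₂ _,_ (FP.inject₁-injective i≡i′) (FP.inject₁-injective j≡j′)))
lowerPairStep-injective n {inj₁ k} {inj₂ j} eq = ⊥-elim (FP.fromℕ≢inject₁ (sym (,-injectiveˡ eq)))
lowerPairStep-injective n {inj₂ j} {inj₁ k} eq = ⊥-elim (FP.fromℕ≢inject₁ (,-injectiveˡ eq))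
lowerPairStep-injective n {inj₂ j} {inj₂ j′} eq = cong inj₂ (,-injectiveʳ eq)

injective⇒surjective : ∀ {m} {f : Fin m → Fin m} → Injective _≡_ _≡_ f → ∀ y → ∃ λ x → f x ≡ y
injective⇒surjective {suc m} {f} f-inj y with FP.any? (λ x → f x FP.≟ y)
... | yes hit  = hit
... | no  miss = ⊥-elim (FP.<⇒notInjective (ℕP.n<1+n m) punchOut-injective)
  where
  missed : ∀ x → y ≢ f x
  missed x y≡fx = miss (x , sym y≡fx)
  punchOut-injective : Injective _≡_ _≡_ (λ x → punchOut (missed x))
  punchOut-injective eq = f-inj (FP.punchOut-injective (missed _) (missed _) eq)

DistinctNeighbours : ∀ {N} → ℕ → LGraph N → Fin N → Set
DistinctNeighbours {N} k G w = Σ (Fin k → Fin N) λ f → Injective _≡_ _≡_ f × (∀ i → Adj G w (f i))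

permutation-injective : ∀ {N} (τ : Permutation N N) → Injective _≡_ _≡_ (τ ⟨$⟩ʳ_)
permutation-injective τ = Injection.injective (↔⇒↣ τ)

permutation-≡⇔ : ∀ {N} (τ : Permutation N N) {x a} → τ ⟨$⟩ˡ x ≡ a ⇔ x ≡ τ ⟨$⟩ʳ a
permutation-≡⇔ τ = mk⇔ (λ eq → sym (Inverse.inverseˡ τ (sym eq))) (Inverse.inverseʳ τ)

module Transport {N} {G H : LGraph N} (τ : Permutation N N) (τ-maps : Maps G H τ) where

  Maps-flip : Maps H G (flip τ)
  Maps-flip i j = sym (trans (τ-maps (τ ⟨$⟩ˡ i) (τ ⟨$⟩ˡ j)) (cong₂ H (inverseʳ τ) (inverseʳ τ)))

  Adj-transport : ∀ {i j} → Adj G i j ⇔ Adj H (τ ⟨$⟩ʳ i) (τ ⟨$⟩ʳ j)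
  Adj-transport {i} {j} = mk⇔
    (Prod.map (_∘ permutation-injective τ) (_∘ trans (τ-maps i j)))
    (Prod.map (_∘ cong (τ ⟨$⟩ʳ_)) (_∘ trans (sym (τ-maps i j))))

  neighboursExactly-transport : ∀ {w a b} → NeighboursExactly G w a b →
    NeighboursExactly H (τ ⟨$⟩ʳ w) (τ ⟨$⟩ʳ a) (τ ⟨$⟩ʳ b)
  neighboursExactly-transport {w} nb x =
    ⇔.trans (mk⇔ (subst (Adj H _) (sym (inverseʳ τ))) (subst (Adj H _) (inverseʳ τ)))
    (⇔.trans (⇔.sym Adj-transport)
    (⇔.trans (nb (τ ⟨$⟩ˡ x))
             (permutation-≡⇔ τ ⊎-⇔ permutation-≡⇔ τ)))

  distinctNeighbours-transport : ∀ {k w} → DistinctNeighbours k G w → DistinctNeighbours k H (τ ⟨$⟩ʳ w)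
  distinctNeighbours-transport (f , f-inj , adj) =
    (τ ⟨$⟩ʳ_) ∘ f , f-inj ∘ permutation-injective τ , to Adj-transport ∘ adj

neighboursExactly⇒¬3DistinctNeighbours : ∀ {N} {G : LGraph N} {w a b} →
  NeighboursExactly G w a b → ¬ DistinctNeighbours 3 G w
neighboursExactly⇒¬3DistinctNeighbours {a = a} {b} nb (f , f-inj , adj) =
  FP.<⇒notInjective (ℕP.n<1+n 2) (λ eq → f-inj (sameSide (side _) (side _) eq))
  where
  side : ∀ i → f i ≡ a ⊎ f i ≡ b
  side i = to (nb (f i)) (adj i)
  sideIndex : ∀ {x} → x ≡ a ⊎ x ≡ b → Fin 2
  sideIndex (inj₁ _) = F.zero
  sideIndex (inj₂ _) = F.suc F.zero
  sameSide : ∀ {x y} (p : x ≡ a ⊎ x ≡ b) (q : y ≡ a ⊎ y ≡ b) → sideIndex p ≡ sideIndex q → x ≡ y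
  sameSide (inj₁ refl) (inj₁ refl) _ = refl
  sameSide (inj₂ refl) (inj₂ refl) _ = refl

freshInjection : ∀ {k n} → k < n → (u : Fin n) →
  Σ (Fin k → Fin n) λ f → Injective _≡_ _≡_ f × (∀ i → f i ≢ u)
freshInjection (s≤s k≤m) u =
  (λ i → F.punchIn u (F.inject≤ i k≤m)) ,
  (λ eq → FP.inject≤-injective _ _ _ _ (FP.punchIn-injective u _ _ eq)) ,
  (λ i → FP.punchInᵢ≢i u _)

basicV-injective : ∀ n → Injective _≡_ _≡_ (basicV n)
basicV-injective n = FP.inject≤-injective _ _ _ _

basicV-isBasic : ∀ n u → IsBasicVertex n (basicV n u)
basicV-isBasic n u = subst (_< n) (sym (FP.toℕ-inject≤ u (n≤n₁ n))) (FP.toℕ<n u)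

module BindingGraph {n : ℕ} {G : LGraph (n₁ n)} (G-binding : IsBindingGraph n G) where
  open IsBindingGraph G-binding
  open IsSimple simple

  bindV : (u v : Fin n) → u ≢ v → Fin (n₁ n)
  bindV u v u≢v = proj₁ (binding u v u≢v)

  bindV-isBinding : ∀ u v u≢v → IsBindingVertex n (bindV u v u≢v)
  bindV-isBinding u v u≢v = proj₁ (proj₁ (proj₂ (binding u v u≢v)))

  bindV-neighbours : ∀ u v u≢v → NeighboursExactly G (bindV u v u≢v) (basicV n u) (basicV n v)
  bindV-neighbours u v u≢v = proj₂ (proj₁ (proj₂ (binding u v u≢v)))

  bindV-unique : ∀ u v u≢v {w} → IsBindingVertex n w →
    NeighboursExactly G w (basicV n u) (basicV n v) → bindV u v u≢v ≡ w
  bindV-unique u v u≢v w-binding w-nb = proj₂ (proj₂ (binding u v u≢v)) (w-binding , w-nb)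

  bindV-cong : ∀ {u v u′ v′ u≢v u′≢v′} → u ≡ u′ → v ≡ v′ → bindV u v u≢v ≡ bindV u′ v′ u′≢v′
  bindV-cong {u} {v} {u≢v = u≢v} {u′≢v′} refl refl =
    bindV-unique u v u≢v (bindV-isBinding u v u′≢v′) (bindV-neighbours u v u′≢v′)

  bindV-comm : ∀ {u v u≢v v≢u} → bindV u v u≢v ≡ bindV v u v≢u
  bindV-comm {u} {v} {u≢v} {v≢u} = bindV-unique u v u≢v (bindV-isBinding v u v≢u)
    (λ x → ⇔.trans (bindV-neighbours v u v≢u x) (mk⇔ Sum.swap Sum.swap))

  bindV-injective : ∀ {u v u′ v′ u≢v u′≢v′} → bindV u v u≢v ≡ bindV u′ v′ u′≢v′ →
    (u ≡ u′ × v ≡ v′) ⊎ (u ≡ v′ × v ≡ u′)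
  bindV-injective {u} {v} {u′} {v′} =
    distinct u v u′ v′ _ _ (bindV-neighbours u v _) (bindV-neighbours u′ v′ _)

  basicV≢bindV : ∀ {w u v u≢v} → basicV n w ≢ bindV u v u≢v
  basicV≢bindV {w} eq = ℕP.<⇒≱ (basicV-isBasic n w) (subst (IsBindingVertex n) (sym eq) (bindV-isBinding _ _ _))

  Adj-sym : ∀ {i j} → Adj G i j → Adj G j i
  Adj-sym {i} {j} (i≢j , gij≢x₀) = i≢j ∘ sym , gij≢x₀ ∘ trans (symmetric i j)

  data Vertex (x : Fin (n₁ n)) : Set where
    basic : ∀ u → x ≡ basicV n u → Vertex x
    bound : ∀ u v u≢v → x ≡ bindV u v u≢v → Vertex x

  pairVertex : Fin n × Fin n → Fin (n₁ n)
  pairVertex (i , j) with i FP.≟ j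
  ... | yes _   = basicV n i
  ... | no  i≢j = bindV i j i≢j

  pairVertex-vertex : ∀ p → Vertex (pairVertex p)
  pairVertex-vertex (i , j) with i FP.≟ j
  ... | yes _   = basic i refl
  ... | no  i≢j = bound i j i≢j refl

  pairVertex-injective : ∀ {p q} → LowerPair p → LowerPair q → pairVertex p ≡ pairVertex q → p ≡ q
  pairVertex-injective {i , j} {i′ , j′} _ _ eq with i FP.≟ j | i′ FP.≟ j′
  ... | yes refl | yes refl = cong (λ k → k , k) (basicV-injective n eq)
  ... | yes _    | no  _    = ⊥-elim (basicV≢bindV eq)
  ... | no  _    | yes _    = ⊥-elim (basicV≢bindV (sym eq))
  pairVertex-injective p-low q-low eq | no i≢j | no _ with bindV-injective eq
  ... | inj₁ (refl , refl) = refl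
  ... | inj₂ (refl , refl) = ⊥-elim (i≢j (FP.≤-antisym q-low p-low))

  vertex : ∀ x → Vertex x
  vertex x with injective⇒surjective {f = pairVertex ∘ lowerPair n}
                  (λ {k} {k′} → lowerPair-injective n ∘
                     pairVertex-injective (lowerPair-lower n k) (lowerPair-lower n k′)) x
  ... | k , refl = pairVertex-vertex (lowerPair n k)

  private
    first second : Fin n
    first  = F.fromℕ< (ℕP.<-trans (s≤s z≤n) n≥2)
    second = F.fromℕ< n≥2

    first≢second : first ≢ second
    first≢second eq with trans (sym (FP.toℕ-fromℕ< _)) (trans (cong toℕ eq) (FP.toℕ-fromℕ< n≥2))
    ... | ()

  label : Sym
  label = G (bindV first second first≢second) (basicV n first)

  label≢x₀ : label ≢ x₀
  label≢x₀ = proj₂ (from (bindV-neighbours first second first≢second (basicV n first)) (inj₁ refl))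

  label-occurs : Occurs G label
  label-occurs = _ , _ , refl

  entry-x₀⊎label : ∀ i j → G i j ≡ x₀ ⊎ G i j ≡ label
  entry-x₀⊎label i j with twoVars (G i j) x₀ label (i , j , refl) (i , i , diag i) label-occurs
  ... | inj₁ gij≡x₀           = inj₁ gij≡x₀
  ... | inj₂ (inj₁ gij≡label) = inj₂ gij≡label
  ... | inj₂ (inj₂ x₀≡label)  = ⊥-elim (label≢x₀ (sym x₀≡label))

  Adj⇔≡label : ∀ {i j} → Adj G i j ⇔ G i j ≡ label
  Adj⇔≡label {i} {j} = mk⇔ toLabel fromLabel
    where
    toLabel : Adj G i j → G i j ≡ label
    toLabel (_ , gij≢x₀) = Sum.[ ⊥-elim ∘ gij≢x₀ , id ]′ (entry-x₀⊎label i j)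
    fromLabel : G i j ≡ label → Adj G i j
    fromLabel eq = (λ { refl → label≢x₀ (trans (sym eq) (diag i)) }) , label≢x₀ ∘ trans (sym eq)

  basicV-distinctNeighbours : ∀ {k} → k < n → ∀ u → DistinctNeighbours k G (basicV n u)
  basicV-distinctNeighbours k<n u with freshInjection k<n u
  ... | f , f-inj , f≢u =
    (λ i → bindV u (f i) (f≢u i ∘ sym)) ,
    (λ eq → Sum.[ f-inj ∘ proj₂ , (λ (u≡fi′ , _) → ⊥-elim (f≢u _ (sym u≡fi′))) ] (bindV-injective eq)) ,
    (λ i → Adj-sym (from (bindV-neighbours u (f i) _ (basicV n u)) (inj₁ refl)))

  neighboursExactly⇒isBinding : 3 < n → ∀ {w a b} → NeighboursExactly G w a b → IsBindingVertex n w
  neighboursExactly⇒isBinding 3<n {w} nb with vertex w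
  ... | basic u refl = ⊥-elim (neighboursExactly⇒¬3DistinctNeighbours {G = G} nb (basicV-distinctNeighbours 3<n u))
  ... | bound u v u≢v refl = bindV-isBinding u v u≢v

  bindV-nonadjacent : ∀ {u v u≢v u′ v′ u′≢v′} → ¬ Adj G (bindV u v u≢v) (bindV u′ v′ u′≢v′)
  bindV-nonadjacent = Sum.[ basicV≢bindV ∘ sym , basicV≢bindV ∘ sym ]′ ∘ to (bindV-neighbours _ _ _ _)

injective⇒≡⇔ : ∀ {A B : Set} {f : A → B} → Injective _≡_ _≡_ f → ∀ {x y} → x ≡ y ⇔ f x ≡ f y
injective⇒≡⇔ {f = f} f-inj = mk⇔ (cong f) f-inj

module BindingGraphs {n : ℕ} {G H : LGraph (n₁ n)}
                     (G-binding : IsBindingGraph n G) (H-binding : IsBindingGraph n H) where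
  private
    module BG = BindingGraph G-binding
    module BH = BindingGraph H-binding

  sameVars⇒label≡ : SameVars G H → BG.label ≡ BH.label
  sameVars⇒label≡ same with to (same BG.label) BG.label-occurs
  ... | i , j , hij≡label with BH.entry-x₀⊎label i j
  ...   | inj₁ hij≡x₀    = ⊥-elim (BG.label≢x₀ (trans (sym hij≡label) hij≡x₀))
  ...   | inj₂ hij≡label′ = trans (sym hij≡label) hij≡label′

  entry-cong : BG.label ≡ BH.label → ∀ {i j i′ j′} → Adj G i j ⇔ Adj H i′ j′ → G i j ≡ H i′ j′
  entry-cong label≡ {i} {j} {i′} {j′} adj⇔ with BG.entry-x₀⊎label i j | BH.entry-x₀⊎label i′ j′
  ... | inj₁ gij≡x₀ | inj₁ hij≡x₀ = trans gij≡x₀ (sym hij≡x₀)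
  ... | inj₂ gij≡ℓ  | inj₂ hij≡ℓ  = trans gij≡ℓ (trans label≡ (sym hij≡ℓ))
  ... | inj₁ gij≡x₀ | inj₂ hij≡ℓ  = ⊥-elim (proj₂ (from adj⇔ (from BH.Adj⇔≡label hij≡ℓ)) gij≡x₀)
  ... | inj₂ gij≡ℓ  | inj₁ hij≡x₀ = ⊥-elim (proj₂ (to adj⇔ (from BG.Adj⇔≡label gij≡ℓ)) hij≡x₀)

  module _ (3<n : 3 < n) (τ : Permutation (n₁ n) (n₁ n)) (τ-maps : Maps G H τ) where
    private
      module T = Transport {G = G} {H = H} τ τ-maps

    maps-basicV : ∀ u → ∃ λ u′ → τ ⟨$⟩ʳ basicV n u ≡ basicV n u′
    maps-basicV u with BH.vertex (τ ⟨$⟩ʳ basicV n u)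
    ... | BH.basic u′ eq      = u′ , eq
    ... | BH.bound x y x≢y eq = ⊥-elim (neighboursExactly⇒¬3DistinctNeighbours {G = H}
      (subst (λ w → NeighboursExactly H w _ _) (sym eq) (BH.bindV-neighbours x y x≢y))
      (T.distinctNeighbours-transport (BG.basicV-distinctNeighbours 3<n u)))

    maps-bindV : ∀ {u v u′ v′ u≢v u′≢v′} →
      τ ⟨$⟩ʳ basicV n u ≡ basicV n u′ → τ ⟨$⟩ʳ basicV n v ≡ basicV n v′ →
      τ ⟨$⟩ʳ BG.bindV u v u≢v ≡ BH.bindV u′ v′ u′≢v′
    maps-bindV {u} {v} {u′} {v′} {u≢v} {u′≢v′} τu≡u′ τv≡v′ =
      sym (BH.bindV-unique u′ v′ u′≢v′ (BH.neighboursExactly⇒isBinding 3<n nb) nb)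
      where
      nb : NeighboursExactly H (τ ⟨$⟩ʳ BG.bindV u v u≢v) (basicV n u′) (basicV n v′)
      nb = subst₂ (NeighboursExactly H _) τu≡u′ τv≡v′
             (T.neighboursExactly-transport (BG.bindV-neighbours u v u≢v))

    maps-isBasic : ∀ {u} → IsBasicVertex n u → IsBasicVertex n (τ ⟨$⟩ʳ u)
    maps-isBasic {u} u-basic with BG.vertex u
    ... | BG.basic u′ refl      = subst (IsBasicVertex n) (sym (proj₂ (maps-basicV u′))) (basicV-isBasic n _)
    ... | BG.bound u′ v′ _ refl = ⊥-elim (ℕP.<⇒≱ u-basic (BG.bindV-isBinding u′ v′ _))

  module Extension (s : Fin n → Fin n) (s-inj : Injective _≡_ _≡_ s) where

    extendVertex : ∀ {x} → BG.Vertex x → Fin (n₁ n)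
    extendVertex (BG.basic u _)       = basicV n (s u)
    extendVertex (BG.bound u v u≢v _) = BH.bindV (s u) (s v) (u≢v ∘ s-inj)

    extend : Fin (n₁ n) → Fin (n₁ n)
    extend x = extendVertex (BG.vertex x)

    extend-basicV : ∀ u → extend (basicV n u) ≡ basicV n (s u)
    extend-basicV u with BG.vertex (basicV n u)
    ... | BG.basic u′ eq    = cong (basicV n ∘ s) (basicV-injective n (sym eq))
    ... | BG.bound _ _ _ eq = ⊥-elim (BG.basicV≢bindV eq)

    extend-bindV : ∀ u v u≢v → extend (BG.bindV u v u≢v) ≡ BH.bindV (s u) (s v) (u≢v ∘ s-inj)
    extend-bindV u v u≢v with BG.vertex (BG.bindV u v u≢v)
    ... | BG.basic _ eq          = ⊥-elim (BG.basicV≢bindV (sym eq))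
    ... | BG.bound u′ v′ _ eq with BG.bindV-injective eq
    ...   | inj₁ (u≡u′ , v≡v′) = BH.bindV-cong (cong s (sym u≡u′)) (cong s (sym v≡v′))
    ...   | inj₂ (u≡v′ , v≡u′) =
      trans (BH.bindV-cong {u′≢v′ = u≢v ∘ s-inj ∘ sym} (cong s (sym v≡u′)) (cong s (sym u≡v′)))
            (BH.bindV-comm {v≢u = u≢v ∘ s-inj})

    bindV-basicV-adjacency : ∀ u v u≢v w →
      Adj G (BG.bindV u v u≢v) (basicV n w) ⇔ Adj H (BH.bindV (s u) (s v) (u≢v ∘ s-inj)) (basicV n (s w))
    bindV-basicV-adjacency u v u≢v w =
      ⇔.trans (BG.bindV-neighbours u v u≢v _)
        (⇔.trans (relabel ⊎-⇔ relabel) (⇔.sym (BH.bindV-neighbours _ _ _ _)))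
      where
      relabel : ∀ {x} → basicV n w ≡ basicV n x ⇔ basicV n (s w) ≡ basicV n (s x)
      relabel = ⇔.trans (⇔.sym (injective⇒≡⇔ (basicV-injective n)))
                  (⇔.trans (injective⇒≡⇔ s-inj) (injective⇒≡⇔ (basicV-injective n)))

    extend-maps : BG.label ≡ BH.label →
      (∀ u v → basicGraph n G u v ≡ basicGraph n H (s u) (s v)) →
      ∀ i j → G i j ≡ H (extend i) (extend j)
    extend-maps label≡ basic-maps i j with BG.vertex i | BG.vertex j
    ... | BG.basic u refl       | BG.basic v refl       = basic-maps u v
    ... | BG.bound u v u≢v refl | BG.basic w refl       =
      entry-cong label≡ (bindV-basicV-adjacency u v u≢v w)
    ... | BG.basic w refl       | BG.bound u v u≢v refl =
      entry-cong label≡ (⇔.trans (mk⇔ BG.Adj-sym BG.Adj-sym)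
        (⇔.trans (bindV-basicV-adjacency u v u≢v w) (mk⇔ BH.Adj-sym BH.Adj-sym)))
    ... | BG.bound _ _ _ refl   | BG.bound _ _ _ refl   =
      entry-cong label≡ (mk⇔ (⊥-elim ∘ BG.bindV-nonadjacent) (⊥-elim ∘ BH.bindV-nonadjacent))

module ExtensionInverse {n : ℕ} {G H : LGraph (n₁ n)}
                        (G-binding : IsBindingGraph n G) (H-binding : IsBindingGraph n H)
                        {s s′ : Fin n → Fin n} (s-inj : Injective _≡_ _≡_ s) (s′-inj : Injective _≡_ _≡_ s′) where
  private
    module Forth = BindingGraphs.Extension G-binding H-binding s s-inj
    module Back  = BindingGraphs.Extension H-binding G-binding s′ s′-inj

  extend-inverse : (∀ u → s′ (s u) ≡ u) → ∀ x → Back.extend (Forth.extend x) ≡ x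
  extend-inverse s′∘s x with BindingGraph.vertex G-binding x
  ... | BindingGraph.basic u refl =
    trans (Back.extend-basicV (s u)) (cong (basicV n) (s′∘s u))
  ... | BindingGraph.bound u v u≢v refl =
    trans (Back.extend-bindV (s u) (s v) _) (BindingGraph.bindV-cong G-binding (s′∘s u) (s′∘s v))

module Isomorphisms {n : ℕ} {G H : LGraph (n₁ n)}
                    (G-binding : IsBindingGraph n G) (H-binding : IsBindingGraph n H) where
  private
    module BG = BindingGraph G-binding
    module BH = BindingGraph H-binding
    module GH = BindingGraphs G-binding H-binding
    module HG = BindingGraphs H-binding G-binding
    module Forth (σ : Permutation n n) = GH.Extension (σ ⟨$⟩ʳ_) (permutation-injective σ)
    module Back (σ : Permutation n n) = HG.Extension (σ ⟨$⟩ˡ_) (permutation-injective (flip σ))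

  extension : Permutation n n → Permutation (n₁ n) (n₁ n)
  extension σ = permutation (Forth.extend σ) (Back.extend σ)
    (ExtensionInverse.extend-inverse H-binding G-binding _ _ (λ _ → inverseʳ σ))
    (ExtensionInverse.extend-inverse G-binding H-binding _ _ (λ _ → inverseˡ σ))

  extension-basicV : ∀ σ u → extension σ ⟨$⟩ʳ basicV n u ≡ basicV n (σ ⟨$⟩ʳ u)
  extension-basicV σ = Forth.extend-basicV σ

  extension-maps : BG.label ≡ BH.label → ∀ σ →
    Maps (basicGraph n G) (basicGraph n H) σ → Maps G H (extension σ)
  extension-maps label≡ σ = Forth.extend-maps σ label≡

  module Restriction (3<n : 3 < n) (τ : Permutation (n₁ n) (n₁ n)) (τ-maps : Maps G H τ) where
    private
      forth : ∀ u → ∃ λ u′ → τ ⟨$⟩ʳ basicV n u ≡ basicV n u′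
      forth = GH.maps-basicV 3<n τ τ-maps
      back : ∀ u → ∃ λ u′ → τ ⟨$⟩ˡ basicV n u ≡ basicV n u′
      back = HG.maps-basicV 3<n (flip τ) (Transport.Maps-flip {G = G} {H = H} τ τ-maps)

    restriction : Permutation n n
    restriction = permutation (proj₁ ∘ forth) (proj₁ ∘ back)
      (λ u → basicV-injective n (begin
        basicV n (proj₁ (forth (proj₁ (back u)))) ≡⟨ sym (proj₂ (forth _)) ⟩
        τ ⟨$⟩ʳ basicV n (proj₁ (back u))          ≡⟨ cong (τ ⟨$⟩ʳ_) (sym (proj₂ (back u))) ⟩
        τ ⟨$⟩ʳ (τ ⟨$⟩ˡ basicV n u)                ≡⟨ inverseʳ τ ⟩
        basicV n u                                ∎))
      (λ u → basicV-injective n (begin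
        basicV n (proj₁ (back (proj₁ (forth u)))) ≡⟨ sym (proj₂ (back _)) ⟩
        τ ⟨$⟩ˡ basicV n (proj₁ (forth u))         ≡⟨ cong (τ ⟨$⟩ˡ_) (sym (proj₂ (forth u))) ⟩
        τ ⟨$⟩ˡ (τ ⟨$⟩ʳ basicV n u)                ≡⟨ inverseˡ τ ⟩
        basicV n u                                ∎))
      where open ≡-Reasoning

    restriction-basicV : ∀ u → τ ⟨$⟩ʳ basicV n u ≡ basicV n (restriction ⟨$⟩ʳ u)
    restriction-basicV u = proj₂ (forth u)

    restriction-basicVˡ : ∀ u → τ ⟨$⟩ˡ basicV n u ≡ basicV n (restriction ⟨$⟩ˡ u)
    restriction-basicVˡ u = proj₂ (back u)

    restriction-bindV : ∀ u v u≢v → τ ⟨$⟩ʳ BG.bindV u v u≢v ≡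
      BH.bindV (restriction ⟨$⟩ʳ u) (restriction ⟨$⟩ʳ v) (u≢v ∘ permutation-injective restriction)
    restriction-bindV u v u≢v = GH.maps-bindV 3<n τ τ-maps (restriction-basicV u) (restriction-basicV v)

    restriction-maps : Maps (basicGraph n G) (basicGraph n H) restriction
    restriction-maps u v = trans (τ-maps (basicV n u) (basicV n v))
                                 (cong₂ H (restriction-basicV u) (restriction-basicV v))

module AutomorphismGroup {n : ℕ} {G : LGraph (n₁ n)} (3<n : 3 < n) (G-binding : IsBindingGraph n G) where
  private
    module BG = BindingGraph G-binding
    open Isomorphisms G-binding G-binding
    module R (σ : Aut G) = Restriction 3<n (proj₁ σ) (proj₂ σ)
    module A = RawGroup (AutRawGroup G)
    module B = RawGroup (AutRawGroup (basicGraph n G))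
  open GroupMorphisms (AutRawGroup G) (AutRawGroup (basicGraph n G))

  restrictAut : Aut G → Aut (basicGraph n G)
  restrictAut σ = R.restriction σ , R.restriction-maps σ

  private
    restrictAut-basicV : ∀ σ u → proj₁ σ ⟨$⟩ʳ basicV n u ≡ basicV n (proj₁ (restrictAut σ) ⟨$⟩ʳ u)
    restrictAut-basicV σ = R.restriction-basicV σ

  restrictAut-cong : ∀ {σ τ} → σ A.≈ τ → restrictAut σ B.≈ restrictAut τ
  restrictAut-cong {σ} {τ} σ≈τ u = basicV-injective n
    (trans (sym (restrictAut-basicV σ u)) (trans (σ≈τ _) (restrictAut-basicV τ u)))

  restrictAut-∙ : ∀ σ τ → restrictAut (σ A.∙ τ) B.≈ restrictAut σ B.∙ restrictAut τ
  restrictAut-∙ σ τ u = basicV-injective n (begin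
    basicV n (proj₁ (restrictAut (σ A.∙ τ)) ⟨$⟩ʳ u)            ≡⟨ sym (restrictAut-basicV (σ A.∙ τ) u) ⟩
    proj₁ τ ⟨$⟩ʳ (proj₁ σ ⟨$⟩ʳ basicV n u)                     ≡⟨ cong (proj₁ τ ⟨$⟩ʳ_) (restrictAut-basicV σ u) ⟩
    proj₁ τ ⟨$⟩ʳ basicV n (proj₁ (restrictAut σ) ⟨$⟩ʳ u)       ≡⟨ restrictAut-basicV τ _ ⟩
    basicV n (proj₁ (restrictAut σ B.∙ restrictAut τ) ⟨$⟩ʳ u) ∎)
    where open ≡-Reasoning

  restrictAut-ε : restrictAut A.ε B.≈ B.ε
  restrictAut-ε u = basicV-injective n (sym (restrictAut-basicV A.ε u))

  restrictAut-⁻¹ : ∀ σ → restrictAut (σ A.⁻¹) B.≈ restrictAut σ B.⁻¹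
  restrictAut-⁻¹ σ u = basicV-injective n
    (trans (sym (restrictAut-basicV (σ A.⁻¹) u)) (R.restriction-basicVˡ σ u))

  restrictAut-injective : ∀ {σ τ} → restrictAut σ B.≈ restrictAut τ → σ A.≈ τ
  restrictAut-injective {σ} {τ} σ≈τ i with BG.vertex i
  ... | BG.basic u refl =
    trans (restrictAut-basicV σ u) (trans (cong (basicV n) (σ≈τ u)) (sym (restrictAut-basicV τ u)))
  ... | BG.bound u v u≢v refl =
    trans (R.restriction-bindV σ u v u≢v)
      (trans (BG.bindV-cong (σ≈τ u) (σ≈τ v)) (sym (R.restriction-bindV τ u v u≢v)))

  restrictAut-surjective : ∀ ρ → ∃ λ σ → ∀ {τ} → τ A.≈ σ → restrictAut τ B.≈ ρ
  restrictAut-surjective (ρ , ρ-maps) = (extension ρ , extension-maps refl ρ ρ-maps) ,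
    λ {τ} τ≈extension u → basicV-injective n
      (trans (sym (restrictAut-basicV τ u)) (trans (τ≈extension _) (extension-basicV ρ u)))

  restrictAut-isGroupIsomorphism : IsGroupIsomorphism restrictAut
  restrictAut-isGroupIsomorphism = record
    { isGroupMonomorphism = record
      { isGroupHomomorphism = record
        { isMonoidHomomorphism = record
          { isMagmaHomomorphism = record
            { isRelHomomorphism = record { cong = restrictAut-cong }
            ; homo = restrictAut-∙
            }
          ; ε-homo = restrictAut-ε
          }
        ; ⁻¹-homo = restrictAut-⁻¹
        }
      ; injective = restrictAut-injective
      }
    ; surjective = restrictAut-surjective
    }

theorem5p2 : (n : ℕ) → 3 < n → (B₁ B₂ : LGraph (n₁ n)) →
    IsBindingGraph n B₁ → IsBindingGraph n B₂ → SameVars B₁ B₂ →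
    (∀ u w → IsBasicVertex n u → IsBindingVertex n w → ¬ SameOrbit B₁ u w)
    × ((basicGraph n B₁ ≅ basicGraph n B₂) ⇔ (B₁ ≅ B₂))
    × AutIsomorphic B₁ (basicGraph n B₁)
theorem5p2 n 3<n B₁ B₂ B₁-binding B₂-binding same-vars =
  differentOrbits , mk⇔ extend-iso restrict-iso , restrictAut , restrictAut-isGroupIsomorphism
  where
  open Isomorphisms B₁-binding B₂-binding
  open AutomorphismGroup 3<n B₁-binding

  differentOrbits : ∀ u w → IsBasicVertex n u → IsBindingVertex n w → ¬ SameOrbit B₁ u w
  differentOrbits u w u-basic w-binding ((σ , σ-maps) , σu≡w) = ℕP.<⇒≱
    (subst (IsBasicVertex n) σu≡w (BindingGraphs.maps-isBasic B₁-binding B₁-binding 3<n σ σ-maps u-basic))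
    w-binding

  extend-iso : basicGraph n B₁ ≅ basicGraph n B₂ → B₁ ≅ B₂
  extend-iso (σ , σ-maps) =
    extension σ , extension-maps (BindingGraphs.sameVars⇒label≡ B₁-binding B₂-binding same-vars) σ σ-maps

  restrict-iso : B₁ ≅ B₂ → basicGraph n B₁ ≅ basicGraph n B₂
  restrict-iso (τ , τ-maps) = Restriction.restriction 3<n τ τ-maps , Restriction.restriction-maps 3<n τ τ-maps
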